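{- Let $A \in \mathbb{F}_2[x]$ be nonzero with Collatz sequence $(A_j)_{j\geq 0}$ and valuations $a_{2k}, b_{2k}$; put $d_k = \deg(A_{2k})$, $\ell_k = \deg(A_{2k+1})$, and let $\ell = \lim_k \ell_k$, $d = \lim_k d_k$. Then there exists $m \geq 0$ such that for every $k \geq m$: $\ell_k = \ell$, $d_k = d$, and $a_{2k} = b_{2k} = 1$.
   Context: A polynomial $S \in \mathbb{F}_2[x]$ is called odd if $\gcd(S, x(x+1)) = 1$. Let $M_1 = x^2+x+1$. For nonzero $S$, $val_x(S)$ and $val_{x+1}(S)$ denote the exponents of $x$ and $x+1$ in $S$. For nonzero $A \in \mathbb{F}_2[x]$ define: $A_0 = A$; for every $k \geq 0$, $a_{2k} = val_x(A_{2k})$, $b_{2k} = val_{x+1}(A_{2k})$, $A_{2k+1} = A_{2k}/(x^{a_{2k}}(x+1)^{b_{2k}})$ (odd); and $A_{2k+2} = 1 + M_1 A_{2k+1}$. The sequences $(\ell_k)$, $(d_k)$ of degrees are known to converge (they are eventually constant integer sequences). -}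

module Defs where

-- Polynomials over F₂ as coefficient lists (little-endian: head = constant
-- coefficient), Bool = F₂ (true = 1).  Canonical representatives have no
-- trailing 'false' (the zero polynomial is []); all operations normalise.

open import Data.Bool using (Bool; true; false; if_then_else_; _xor_)
open import Data.List using (List; []; _∷_; length; drop)
open import Data.Nat using (ℕ; zero; suc; _∸_; _≤_)
open import Data.Product using (_×_; _,_; proj₁; proj₂; ∃-syntax)

Poly : Set
Poly = List Bool

cons : Bool → Poly → Poly
cons false [] = []
cons b q = b ∷ q

norm : Poly → Poly
norm [] = []
norm (b ∷ p) = cons b (norm p)

addRaw : Poly → Poly → Poly
addRaw [] q = q
addRaw p [] = p
addRaw (a ∷ p) (b ∷ q) = (a xor b) ∷ addRaw p q

_⊕_ : Poly → Poly → Poly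
p ⊕ q = norm (addRaw p q)

_⊗_ : Poly → Poly → Poly
[] ⊗ q = []
(b ∷ p) ⊗ q = (if b then q else []) ⊕ (norm (false ∷ (p ⊗ q)))

one : Poly
one = true ∷ []

M₁ : Poly
M₁ = true ∷ true ∷ true ∷ []

-- degree of a (normalised, nonzero) polynomial
deg : Poly → ℕ
deg p = length p ∸ 1

valX : Poly → ℕ
valX (false ∷ p) = suc (valX p)
valX _ = 0

stripX : Poly → Poly
stripX p = drop (valX p) p

-- Euclidean division by (x+1): returns (quotient, remainder) with carry c
divX1go : Bool → Poly → Poly × Bool
divX1go c [] = [] , c
divX1go c (a ∷ []) = [] , (c xor a)
divX1go c (a ∷ b ∷ p) =
  let q = c xor a
      r = divX1go q (b ∷ p)
  in (q ∷ proj₁ r) , proj₂ r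

divX1 : Poly → Poly × Bool
divX1 p = divX1go false p

-- repeatedly divide by (x+1) while exact; returns (exponent, cofactor).
-- fuel = length p suffices since each exact division lowers the degree.
val1go : ℕ → Poly → ℕ × Poly
val1go zero p = 0 , p
val1go (suc f) [] = 0 , []
val1go (suc f) (a ∷ p) with divX1 (a ∷ p)
... | q , true = 0 , (a ∷ p)
... | q , false = let r = val1go f (norm q) in suc (proj₁ r) , proj₂ r

valX1 : Poly → ℕ
valX1 p = proj₁ (val1go (length p) p)

oddPart : Poly → Poly
oddPart p = proj₂ (val1go (length (stripX p)) (stripX p))

-- Collatz sequence: evenA A k = A_{2k}, oddA A k = A_{2k+1}
evenA : Poly → ℕ → Poly
oddA : Poly → ℕ → Poly
evenA A zero = norm A
evenA A (suc k) = one ⊕ (M₁ ⊗ oddA A k)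
oddA A k = oddPart (evenA A k)

a₂ : Poly → ℕ → ℕ
a₂ A k = valX (evenA A k)
b₂ : Poly → ℕ → ℕ
b₂ A k = valX1 (evenA A k)
dSeq : Poly → ℕ → ℕ
dSeq A k = deg (evenA A k)
ℓSeq : Poly → ℕ → ℕ
ℓSeq A k = deg (oddA A k)

-- limit of an integer sequence (eventually constant with value L)
_⟶_ : (ℕ → ℕ) → ℕ → Set
s ⟶ L = ∃[ N ] (∀ k → N ≤ k → s k ≡ L)
  where open import Relation.Binary.PropositionalEquality using (_≡_)

-- From k ≥ 1 on, A_{2k} = 1 + M₁ A_{2k-1} with A_{2k-1} odd, so A_{2k} vanishes at 0 and
-- at 1 (a_{2k}, b_{2k} ≥ 1), and it is nonzero because it takes the value 1 at a root of
-- M₁ in F₄.  Degrees give d_k ≥ a_{2k} + b_{2k} + ℓ_k and d_{k+1} ≤ ℓ_k + 2, so as soon as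
-- d_k = d_{k+1} we get a_{2k} + b_{2k} ≤ 2, i.e. a_{2k} = b_{2k} = 1.
module Submission where

open import Defs
open import Data.Nat using (ℕ; _≤_)
open import Data.List using ([])
open import Data.Product using (_×_; ∃-syntax)
open import Relation.Binary.PropositionalEquality using (_≡_; _≢_)

open import Algebra.Bundles using (CommutativeMonoid; CommutativeRing)
import Algebra.Construct.DirectProduct as DirectProduct
open import Algebra.Morphism.Structures using (IsMonoidHomomorphism)
import Algebra.Morphism.Construct.DirectProduct as DirectProductMorphisms
import Algebra.Morphism.Construct.Identity as IdentityMorphism
import Algebra.Properties.CommutativeSemigroup as CommutativeSemigroupProperties
open import Data.Bool using (Bool; true; false; not; _xor_; if_then_else_)
open import Data.Bool.Properties using (xor-∧-commutativeRing; xor-identityʳ; xor-same; xor-assoc)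
open import Data.Empty using (⊥-elim)
open import Data.List using (_∷_; length)
open import Data.Nat using (zero; suc; _+_; _∸_; _⊔_; z≤n; s≤s)
open import Data.Nat.Properties
  using (≤-refl; ≤-trans; ≤-reflexive; m≤m⊔n; m≤n⊔m; m≤n⇒m≤1+n; m≤n+m; ⊔-lub; m≤n+m∸n; ∸-monoˡ-≤;
         +-monoʳ-≤; +-assoc; +-cancelʳ-≤; m+n≤o⇒n≤o; module ≤-Reasoning)
open import Data.Product using (_,_; proj₁; proj₂; <_,_>)
open import Function using (id; const)
open import Level using (0ℓ)
open import Relation.Binary.PropositionalEquality using (refl; sym; trans; cong; cong₂; subst)
import Relation.Binary.Reasoning.Setoid as SetoidReasoning

collatzStep : Poly → Poly
collatzStep q = one ⊕ (M₁ ⊗ q)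

F₂ : CommutativeMonoid 0ℓ 0ℓ
F₂ = CommutativeRing.+-commutativeMonoid xor-∧-commutativeRing

F₂² : CommutativeMonoid 0ℓ 0ℓ
F₂² = DirectProduct.commutativeMonoid F₂ F₂

-- eval p = Σᵢ σⁱ (ι pᵢ).  With σ the multiplication by an element r of an F₂-algebra this is
-- evaluation at r, but only the additivity of ι and σ is used.
module Horner {c ℓ} (M : CommutativeMonoid c ℓ)
  (ι : Bool → CommutativeMonoid.Carrier M)
  (ι-hom : IsMonoidHomomorphism (CommutativeMonoid.rawMonoid F₂) (CommutativeMonoid.rawMonoid M) ι)
  (σ : CommutativeMonoid.Carrier M → CommutativeMonoid.Carrier M)
  (σ-hom : IsMonoidHomomorphism (CommutativeMonoid.rawMonoid M) (CommutativeMonoid.rawMonoid M) σ) where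

  open CommutativeMonoid M renaming (refl to ≈-refl; sym to ≈-sym; trans to ≈-trans)
  open SetoidReasoning setoid
  open CommutativeSemigroupProperties commutativeSemigroup using (interchange)
  private
    module ι = IsMonoidHomomorphism ι-hom
    module σ = IsMonoidHomomorphism σ-hom

  eval : Poly → Carrier
  eval [] = ε
  eval (b ∷ p) = ι b ∙ σ (eval p)

  eval-false∷ : ∀ p → eval (false ∷ p) ≈ σ (eval p)
  eval-false∷ p = ≈-trans (∙-congʳ ι.ε-homo) (identityˡ _)

  eval-cons : ∀ b p → eval (cons b p) ≈ eval (b ∷ p)
  eval-cons false [] = ≈-sym (≈-trans (eval-false∷ []) σ.ε-homo)
  eval-cons false (_ ∷ _) = ≈-refl
  eval-cons true p = ≈-refl

  eval-norm : ∀ p → eval (norm p) ≈ eval p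
  eval-norm [] = ≈-refl
  eval-norm (b ∷ p) = ≈-trans (eval-cons b (norm p)) (∙-congˡ (σ.⟦⟧-cong (eval-norm p)))

  eval-addRaw : ∀ p q → eval (addRaw p q) ≈ eval p ∙ eval q
  eval-addRaw [] q = ≈-sym (identityˡ _)
  eval-addRaw (a ∷ p) [] = ≈-sym (identityʳ _)
  eval-addRaw (a ∷ p) (b ∷ q) = begin
    ι (a xor b) ∙ σ (eval (addRaw p q))          ≈⟨ ∙-cong (ι.homo a b) (σ.⟦⟧-cong (eval-addRaw p q)) ⟩
    (ι a ∙ ι b) ∙ σ (eval p ∙ eval q)            ≈⟨ ∙-congˡ (σ.homo _ _) ⟩
    (ι a ∙ ι b) ∙ (σ (eval p) ∙ σ (eval q))      ≈⟨ interchange _ _ _ _ ⟩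
    (ι a ∙ σ (eval p)) ∙ (ι b ∙ σ (eval q))      ∎

  eval-⊕ : ∀ p q → eval (p ⊕ q) ≈ eval p ∙ eval q
  eval-⊕ p q = ≈-trans (eval-norm (addRaw p q)) (eval-addRaw p q)

  eval-true∷-⊗ : ∀ p q → eval ((true ∷ p) ⊗ q) ≈ eval q ∙ σ (eval (p ⊗ q))
  eval-true∷-⊗ p q = begin
    eval (q ⊕ norm (false ∷ (p ⊗ q)))            ≈⟨ eval-⊕ q _ ⟩
    eval q ∙ eval (norm (false ∷ (p ⊗ q)))       ≈⟨ ∙-congˡ (eval-norm (false ∷ (p ⊗ q))) ⟩
    eval q ∙ eval (false ∷ (p ⊗ q))              ≈⟨ ∙-congˡ (eval-false∷ (p ⊗ q)) ⟩
    eval q ∙ σ (eval (p ⊗ q))                    ∎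

  eval-one : eval one ≈ ι true
  eval-one = ≈-trans (∙-congˡ σ.ε-homo) (identityʳ _)

  eval-M₁⊗ : ∀ q → eval (M₁ ⊗ q) ≈ eval q ∙ σ (eval q ∙ σ (eval q))
  eval-M₁⊗ q = begin
    eval (M₁ ⊗ q)                                          ≈⟨ eval-true∷-⊗ (true ∷ true ∷ []) q ⟩
    eval q ∙ σ (eval ((true ∷ true ∷ []) ⊗ q))             ≈⟨ ∙-congˡ (σ.⟦⟧-cong (eval-true∷-⊗ (true ∷ []) q)) ⟩
    eval q ∙ σ (eval q ∙ σ (eval ((true ∷ []) ⊗ q)))       ≈⟨ ∙-congˡ (σ.⟦⟧-cong (∙-congˡ (σ.⟦⟧-cong x⊗q))) ⟩
    eval q ∙ σ (eval q ∙ σ (eval q))                       ∎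
    where
    x⊗q : eval ((true ∷ []) ⊗ q) ≈ eval q
    x⊗q = ≈-trans (eval-true∷-⊗ [] q) (≈-trans (∙-congˡ σ.ε-homo) (identityʳ _))

  eval-collatzStep : ∀ q → eval (collatzStep q) ≈ ι true ∙ (eval q ∙ σ (eval q ∙ σ (eval q)))
  eval-collatzStep q = ≈-trans (eval-⊕ one (M₁ ⊗ q)) (∙-cong eval-one (eval-M₁⊗ q))

const-false-hom : IsMonoidHomomorphism (CommutativeMonoid.rawMonoid F₂) (CommutativeMonoid.rawMonoid F₂) (const false)
const-false-hom = record
  { isMagmaHomomorphism = record { isRelHomomorphism = record { cong = const refl } ; homo = λ _ _ → refl }
  ; ε-homo = refl
  }

id-hom : IsMonoidHomomorphism (CommutativeMonoid.rawMonoid F₂) (CommutativeMonoid.rawMonoid F₂) id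
id-hom = IdentityMorphism.isMonoidHomomorphism (CommutativeMonoid.rawMonoid F₂) refl

module At0 = Horner F₂ id id-hom (const false) const-false-hom
module At1 = Horner F₂ id id-hom id id-hom

Odd : Poly → Set
Odd p = At0.eval p ≡ true × At1.eval p ≡ true

at0-collatzStep : ∀ q → At0.eval (collatzStep q) ≡ not (At0.eval q)
at0-collatzStep q = trans (At0.eval-collatzStep q) (cong not (xor-identityʳ (At0.eval q)))

at1-collatzStep : ∀ q → At1.eval (collatzStep q) ≡ not (At1.eval q)
at1-collatzStep q = trans (At1.eval-collatzStep q) (cong not (trans (cong (v xor_) (xor-same v)) (xor-identityʳ v)))
  where v = At1.eval q

mulX : Bool × Bool → Bool × Bool
mulX (a , b) = (b , a xor b)

mulX-hom : IsMonoidHomomorphism (CommutativeMonoid.rawMonoid F₂²) (CommutativeMonoid.rawMonoid F₂²) mulX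
mulX-hom = record
  { isMagmaHomomorphism = record
    { isRelHomomorphism = record { cong = λ { (a≡c , b≡d) → b≡d , cong₂ _xor_ a≡c b≡d } }
    ; homo = λ { (a , b) (c , d) → refl , interchange a c b d }
    }
  ; ε-homo = refl , refl
  }
  where open CommutativeSemigroupProperties (CommutativeMonoid.commutativeSemigroup F₂) using (interchange)

constant-hom : IsMonoidHomomorphism (CommutativeMonoid.rawMonoid F₂) (CommutativeMonoid.rawMonoid F₂²) < id , const false >
constant-hom = DirectProductMorphisms.Monoid.Pair.isMonoidHomomorphism _ _ _ id-hom const-false-hom

-- F₂² is F₂[x]/(M₁) ≅ F₄ in the basis 1, x, and mulX is multiplication by x there; so
-- ModM₁.eval p is the residue of p modulo M₁, i.e. the value of p at a root of M₁.
module ModM₁ = Horner F₂² < id , const false > constant-hom mulX mulX-hom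

open CommutativeMonoid F₂² using () renaming (_≈_ to _≈²_; _∙_ to _+²_; trans to ≈²-trans; ∙-congˡ to +²-congˡ)

mulX-root-of-M₁ : ∀ v → v +² mulX (v +² mulX v) ≈² (false , false)
mulX-root-of-M₁ (false , false) = refl , refl
mulX-root-of-M₁ (false , true) = refl , refl
mulX-root-of-M₁ (true , false) = refl , refl
mulX-root-of-M₁ (true , true) = refl , refl

ModM₁-collatzStep : ∀ q → ModM₁.eval (collatzStep q) ≈² (true , false)
ModM₁-collatzStep q = ≈²-trans (ModM₁.eval-collatzStep q) (+²-congˡ {true , false} (mulX-root-of-M₁ (ModM₁.eval q)))

collatzStep-≢-[] : ∀ q → collatzStep q ≢ []
collatzStep-≢-[] q eq with subst (λ p → ModM₁.eval p ≈² (true , false)) eq (ModM₁-collatzStep q)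
... | () , _

length-cons : ∀ b p → length (cons b p) ≤ suc (length p)
length-cons false [] = z≤n
length-cons false (_ ∷ _) = ≤-refl
length-cons true p = ≤-refl

length-norm : ∀ p → length (norm p) ≤ length p
length-norm [] = z≤n
length-norm (b ∷ p) = ≤-trans (length-cons b (norm p)) (s≤s (length-norm p))

length-addRaw : ∀ p q → length (addRaw p q) ≤ length p ⊔ length q
length-addRaw [] q = ≤-refl
length-addRaw (a ∷ p) [] = ≤-refl
length-addRaw (a ∷ p) (b ∷ q) = s≤s (length-addRaw p q)

length-⊕ : ∀ p q → length (p ⊕ q) ≤ length p ⊔ length q
length-⊕ p q = ≤-trans (length-norm (addRaw p q)) (length-addRaw p q)

length-⊗ : ∀ p q → length (p ⊗ q) ≤ (length p ∸ 1) + length q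
length-⊗ [] q = z≤n
length-⊗ (b ∷ p) q =
  ≤-trans (length-⊕ (if b then q else []) (norm (false ∷ (p ⊗ q))))
          (⊔-lub (≤-trans (length-if b) (m≤n+m (length q) (length p))) (length-x⊗ p))
  where
  length-if : ∀ b → length (if b then q else []) ≤ length q
  length-if true = ≤-refl
  length-if false = z≤n

  length-x⊗ : ∀ p → length (norm (false ∷ (p ⊗ q))) ≤ length p + length q
  length-x⊗ [] = z≤n
  length-x⊗ (c ∷ p) = ≤-trans (length-cons false (norm ((c ∷ p) ⊗ q)))
                              (s≤s (≤-trans (length-norm ((c ∷ p) ⊗ q)) (length-⊗ (c ∷ p) q)))

length-collatzStep : ∀ q → length (collatzStep q) ≤ 2 + length q
length-collatzStep q = ≤-trans (length-⊕ one (M₁ ⊗ q)) (⊔-lub (s≤s z≤n) (length-⊗ M₁ q))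

divX1go-length : ∀ c p → length (proj₁ (divX1go c p)) ≡ length p ∸ 1
divX1go-length c [] = refl
divX1go-length c (a ∷ []) = refl
divX1go-length c (a ∷ b ∷ p) = cong suc (divX1go-length (c xor a) (b ∷ p))

divX1go-remainder : ∀ c p → proj₂ (divX1go c p) ≡ c xor At1.eval p
divX1go-remainder c [] = sym (xor-identityʳ c)
divX1go-remainder c (a ∷ []) = cong (c xor_) (sym (xor-identityʳ a))
divX1go-remainder c (a ∷ b ∷ p) = trans (divX1go-remainder (c xor a) (b ∷ p)) (xor-assoc c a (At1.eval (b ∷ p)))

val1go-length : ∀ f p → proj₁ (val1go f p) + length (proj₂ (val1go f p)) ≤ length p
val1go-length zero p = ≤-refl
val1go-length (suc f) [] = ≤-refl
val1go-length (suc f) (a ∷ p) with divX1go false (a ∷ p) | divX1go-length false (a ∷ p)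
... | Q , true | _ = ≤-refl
... | Q , false | length-Q = s≤s (≤-trans (val1go-length f (norm Q)) (≤-trans (length-norm Q) (≤-reflexive length-Q)))

val1go-odd : ∀ f r → length (true ∷ r) ≤ f → Odd (proj₂ (val1go f (true ∷ r)))
val1go-odd (suc f) [] _ = refl , refl
val1go-odd (suc f) (b ∷ r) (s≤s le)
  with divX1go true (b ∷ r) | divX1go-remainder true (b ∷ r) | divX1go-length true (b ∷ r)
... | Q , true | remainder | _ = refl , sym remainder
... | Q , false | _ | length-Q = val1go-odd f (norm Q) (≤-trans (s≤s (≤-trans (length-norm Q) (≤-reflexive length-Q))) le)

-- x and x + 1 are coprime: (x p) / (x + 1) = x (p / (x + 1)), with the same remainder.
val1go-cons-false : ∀ f p → length p ≤ f → proj₁ (val1go (suc f) (cons false p)) ≡ proj₁ (val1go f p)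
val1go-cons-false zero [] _ = refl
val1go-cons-false (suc f) [] _ = refl
val1go-cons-false (suc f) (c ∷ p) (s≤s le) with divX1go false (c ∷ p) | divX1go-length false (c ∷ p)
... | Q , true | _ = refl
... | Q , false | length-Q =
  cong suc (val1go-cons-false f (norm Q) (≤-trans (length-norm Q) (≤-trans (≤-reflexive length-Q) le)))

valX+length-stripX : ∀ e → valX e + length (stripX e) ≡ length e
valX+length-stripX [] = refl
valX+length-stripX (true ∷ e) = refl
valX+length-stripX (false ∷ e) = cong suc (valX+length-stripX e)

stripX-norm : ∀ X → norm X ≢ [] → ∃[ r ] stripX (norm X) ≡ true ∷ r
stripX-norm [] nz = ⊥-elim (nz refl)
stripX-norm (true ∷ X) nz = norm X , refl
stripX-norm (false ∷ X) nz with norm X | stripX-norm X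
... | [] | _ = ⊥-elim (nz refl)
... | _ ∷ _ | stripX-norm-X = stripX-norm-X (λ ())

valX1-stripX : ∀ e {r} → stripX e ≡ true ∷ r → valX1 e ≡ proj₁ (val1go (length (stripX e)) (stripX e))
valX1-stripX (true ∷ e) _ = refl
valX1-stripX (false ∷ c ∷ e) eq = trans (val1go-cons-false _ (c ∷ e) ≤-refl) (valX1-stripX (c ∷ e) eq)

oddPart-odd : ∀ e {r} → stripX e ≡ true ∷ r → Odd (oddPart e)
oddPart-odd e {r} eq rewrite eq = val1go-odd (suc (length r)) r ≤-refl

valX+valX1+length-oddPart : ∀ e {r} → stripX e ≡ true ∷ r → valX e + (valX1 e + length (oddPart e)) ≤ length e
valX+valX1+length-oddPart e eq rewrite valX1-stripX e eq =
  ≤-trans (+-monoʳ-≤ (valX e) (val1go-length (length (stripX e)) (stripX e))) (≤-reflexive (valX+length-stripX e))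

1≤valX : ∀ e → e ≢ [] → At0.eval e ≡ false → 1 ≤ valX e
1≤valX [] nz _ = ⊥-elim (nz refl)
1≤valX (false ∷ e) _ _ = s≤s z≤n
1≤valX (true ∷ e) _ ()

1≤valX1 : ∀ e → e ≢ [] → At1.eval e ≡ false → 1 ≤ valX1 e
1≤valX1 [] nz _ = ⊥-elim (nz refl)
1≤valX1 (c ∷ e) _ e[1]≡false with divX1go false (c ∷ e) | divX1go-remainder false (c ∷ e)
... | _ , false | _ = s≤s z≤n
... | _ , true | remainder with trans remainder e[1]≡false
... | ()

m+n≤2⇒m≡1×n≡1 : ∀ {m n} → 1 ≤ m → 1 ≤ n → m + n ≤ 2 → m ≡ 1 × n ≡ 1
m+n≤2⇒m≡1×n≡1 {1} {1} _ _ _ = refl , refl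
m+n≤2⇒m≡1×n≡1 {1} {suc (suc n)} _ _ (s≤s (s≤s ()))
m+n≤2⇒m≡1×n≡1 {suc (suc m)} {suc n} _ _ (s≤s (s≤s m+1+n≤0)) with m+n≤o⇒n≤o m m+1+n≤0
... | ()

module _ (A : Poly) (A≢0 : norm A ≢ []) where

  stripX-evenA : ∀ k → ∃[ r ] stripX (evenA A k) ≡ true ∷ r
  stripX-evenA zero = stripX-norm A A≢0
  stripX-evenA (suc k) = stripX-norm (addRaw one (M₁ ⊗ oddA A k)) (collatzStep-≢-[] (oddA A k))

  oddA-odd : ∀ k → Odd (oddA A k)
  oddA-odd k = oddPart-odd (evenA A k) (proj₂ (stripX-evenA k))

  1≤a₂×1≤b₂ : ∀ k → 1 ≤ a₂ A (suc k) × 1 ≤ b₂ A (suc k)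
  1≤a₂×1≤b₂ k =
    1≤valX (collatzStep q) (collatzStep-≢-[] q) (trans (at0-collatzStep q) (cong not (proj₁ (oddA-odd k)))) ,
    1≤valX1 (collatzStep q) (collatzStep-≢-[] q) (trans (at1-collatzStep q) (cong not (proj₂ (oddA-odd k))))
    where q = oddA A k

  dSeq-stable⇒a₂≡1×b₂≡1 : ∀ k → dSeq A (suc k) ≡ dSeq A (suc (suc k)) → a₂ A (suc k) ≡ 1 × b₂ A (suc k) ≡ 1
  dSeq-stable⇒a₂≡1×b₂≡1 k d-stable = m+n≤2⇒m≡1×n≡1 (proj₁ (1≤a₂×1≤b₂ k)) (proj₂ (1≤a₂×1≤b₂ k)) a+b≤2
    where
    e = evenA A (suc k)
    L = length (oddA A (suc k))
    a+b≤2 : a₂ A (suc k) + b₂ A (suc k) ≤ 2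
    a+b≤2 = +-cancelʳ-≤ L _ 2 (begin
      a₂ A (suc k) + b₂ A (suc k) + L     ≡⟨ +-assoc (a₂ A (suc k)) _ L ⟩
      a₂ A (suc k) + (b₂ A (suc k) + L)   ≤⟨ valX+valX1+length-oddPart e (proj₂ (stripX-evenA (suc k))) ⟩
      length e                            ≤⟨ m≤n+m∸n (length e) 1 ⟩
      suc (dSeq A (suc k))                ≡⟨ cong suc d-stable ⟩
      suc (dSeq A (suc (suc k)))          ≤⟨ s≤s (∸-monoˡ-≤ 1 (length-collatzStep (oddA A (suc k)))) ⟩
      2 + L                               ∎)
      where open ≤-Reasoning

corollary2p5 : (A : Poly) → norm A ≢ [] → (ℓ d : ℕ) → ℓSeq A ⟶ ℓ → dSeq A ⟶ d →
    ∃[ m ] (∀ k → m ≤ k →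
      (ℓSeq A k ≡ ℓ) × (dSeq A k ≡ d) × (a₂ A k ≡ 1) × (b₂ A k ≡ 1))
corollary2p5 A A≢0 ℓ d (N , ℓ-limit) (M , d-limit) = suc (N ⊔ M) , eventually
  where
  eventually : ∀ k → suc (N ⊔ M) ≤ k → (ℓSeq A k ≡ ℓ) × (dSeq A k ≡ d) × (a₂ A k ≡ 1) × (b₂ A k ≡ 1)
  eventually (suc k) (s≤s N⊔M≤k) =
    ℓ-limit (suc k) N≤1+k , d-limit (suc k) M≤1+k ,
    dSeq-stable⇒a₂≡1×b₂≡1 A A≢0 k (trans (d-limit (suc k) M≤1+k) (sym (d-limit (suc (suc k)) (m≤n⇒m≤1+n M≤1+k))))
    where
    N≤1+k : N ≤ suc k
    N≤1+k = m≤n⇒m≤1+n (≤-trans (m≤m⊔n N M) N⊔M≤k)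
    M≤1+k : M ≤ suc k
    M≤1+k = m≤n⇒m≤1+n (≤-trans (m≤n⊔m N M) N⊔M≤k)
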